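{- Let $G=(V,E)$ be a directed graph with $E\subseteq V\times V$, and let $s,t\in V$ be such that $s$ is a source of $G$ (no edge of $E$ enters $s$) and $t$ is a sink of $G$ (no edge of $E$ leaves $t$). Let $W\subseteq E$ be a set of edges, and for every $(u,v)\in E$ put $W(u,v)=1$ if $(u,v)\in W$ and $W(u,v)=0$ otherwise. Then the edges of $W$ can be ordered so as to form an $s$-$t$ trail that passes through every edge of $W$ (and through no other edge) if and only if the following two conditions hold: (1) for every $v\in V$, $$\sum_{(u,v)\in E} W(u,v)-\sum_{(v,u)\in E} W(v,u)=\begin{cases}0,& v\in V\setminus\{s,t\},\\ 1,& v=t,\\ -1,& v=s;\end{cases}$$ (2) for every strongly connected component $C$ of the subgraph $H$ of $G$ induced by the edges in $W$ (i.e. $H$ has edge set $W$ and node set the endpoints of edges of $W$) with $C\neq\{t\}$, the set $(\delta^+(C)\setminus E(C))\cap W$ is non-empty, where $\delta^+(C)$ is the set of edges $(u,v)\in E$ with $u\in C$ and $E(C)$ is the set of edges of $C$.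
   Context: All graphs are directed and assumed weakly connected. A walk is a sequence of edges in which consecutive edges share an end and a start; an $s$-$t$ walk has first node $s$ and last node $t$. A trail is a walk that passes through each of its edges exactly once (it may repeat nodes). A strongly connected component of a graph is an inclusion-maximal set $C$ of nodes such that for any $x,y\in C$ there is an $x$-$y$ path and a $y$-$x$ path in that graph. -}

module Defs where

open import Data.Nat using (ℕ; zero; suc)
open import Data.Integer using (ℤ; +_; -_; _-_)
open import Data.Bool using (Bool; true; false; if_then_else_)
open import Data.Fin using (Fin; _≟_)
open import Data.Fin.Subset using (Subset; _∈_; _∉_; _⊆_; ⁅_⁆)
open import Data.List using (List; []; _∷_; map; allFin)
open import Data.Nat.ListAction using (sum)
import Data.List.Membership.Propositional as LM
open import Data.List.Relation.Unary.Unique.Propositional using (Unique)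
open import Data.Product using (_×_; _,_; proj₁; proj₂; ∃; ∃-syntax)
open import Data.Sum using (_⊎_)
open import Relation.Nullary using (¬_; does)
open import Relation.Binary.PropositionalEquality using (_≡_; _≢_)
open import Relation.Binary.Construct.Closure.ReflexiveTransitive using (Star)
open import Function.Bundles using (_⇔_)

-- A finite directed graph on node set V = Fin n is given by its edge set
-- E ⊆ V × V, represented by its (decidable) characteristic function.
Graph : ℕ → Set
Graph n = Fin n → Fin n → Bool

Edge : ℕ → Set
Edge n = Fin n × Fin n

module _ {n : ℕ} where

  Adj : Graph n → Fin n → Fin n → Set
  Adj E u v = E u v ≡ true

  WeaklyConnected : Graph n → Set
  WeaklyConnected E = ∀ x y → Star (λ u v → Adj E u v ⊎ Adj E v u) x y

  IsSource : Graph n → Fin n → Set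
  IsSource E s = ∀ u → E u s ≡ false

  IsSink : Graph n → Fin n → Set
  IsSink E t = ∀ v → E t v ≡ false

  SubEdges : Graph n → Graph n → Set
  SubEdges W E = ∀ u v → Adj W u v → Adj E u v

  Wval : Graph n → Fin n → Fin n → ℕ
  Wval W u v = if W u v then 1 else 0

  inSum : Graph n → Graph n → Fin n → ℕ
  inSum E W v = sum (map (λ u → if E u v then Wval W u v else 0) (allFin n))

  outSum : Graph n → Graph n → Fin n → ℕ
  outSum E W v = sum (map (λ u → if E v u then Wval W v u else 0) (allFin n))

  -- right-hand side of condition (1): -1 at s, 1 at t, 0 elsewhere
  -- (s ≢ t is assumed in the theorem, so the case order is irrelevant)
  demand : Fin n → Fin n → Fin n → ℤ
  demand s t v = if does (v ≟ s) then - (+ 1) else (if does (v ≟ t) then + 1 else + 0)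

  Condition1 : Graph n → Graph n → Fin n → Fin n → Set
  Condition1 E W s t = ∀ v → (+ inSum E W v) - (+ outSum E W v) ≡ demand s t v

  -- Subgraph H induced by the edges in W: edge set W, node set the
  -- endpoints of edges of W.
  NodeH : Graph n → Fin n → Set
  NodeH W x = ∃[ y ] (Adj W x y ⊎ Adj W y x)

  ReachH : Graph n → Fin n → Fin n → Set
  ReachH W = Star (Adj W)

  StronglyConnectedSet : Graph n → Subset n → Set
  StronglyConnectedSet W C =
    (∀ x → x ∈ C → NodeH W x) ×
    (∀ x y → x ∈ C → y ∈ C → ReachH W x y × ReachH W y x)

  IsSCC : Graph n → Subset n → Set
  IsSCC W C = StronglyConnectedSet W C ×
              (∀ D → C ⊆ D → StronglyConnectedSet W D → D ⊆ C)

  -- (δ⁺(C) ∖ E(C)) ∩ W is non-empty: some edge (u,v) ∈ E ∩ W with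
  -- u ∈ C and (u,v) not an edge of C, i.e. v ∉ C.
  LeavingWEdge : Graph n → Graph n → Subset n → Set
  LeavingWEdge E W C = ∃[ u ] ∃[ v ] (Adj E u v × Adj W u v × u ∈ C × v ∉ C)

  Condition2 : Graph n → Graph n → Fin n → Set
  Condition2 E W t = ∀ C → IsSCC W C → C ≢ ⁅ t ⁆ → LeavingWEdge E W C

  data WalkEdges : Fin n → List (Edge n) → Fin n → Set where
    single : ∀ {u v} → WalkEdges u ((u , v) ∷ []) v
    cons   : ∀ {u v w es} → WalkEdges v es w → WalkEdges u ((u , v) ∷ es) w

  IsWTrail : Graph n → Fin n → Fin n → List (Edge n) → Set
  IsWTrail W s t es =
    WalkEdges s es t × Unique es ×
    (∀ e → (e LM.∈ es) ⇔ Adj W (proj₁ e) (proj₂ e))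

{-# OPTIONS --safe #-}
-- Condition (1) says that W is balanced except for a surplus out-edge at s and a
-- surplus in-edge at t. Following unused W-edges greedily from s therefore gets stuck
-- only at t and leaves a balanced remainder; whenever the remainder has an edge leaving
-- a node of the trail, a closed trail through that edge is spliced in. If the remainder
-- is nonempty but avoids all nodes of the trail, then every W-edge leaving one of its
-- nodes belongs to it, and as every edge of a balanced graph lies on a closed walk, the
-- W-reachable set of such a node is a strongly connected component of H other than {t}
-- with no leaving W-edge, contradicting (2). Conversely, (1) holds for every trail by
-- counting, and a component C of H meets the trail, whose continuation leads from C to
-- t; so the trail leaves C unless t ∈ C, in which case C = {t} because t is a sink.

module Submission where

open import Defs

open import Data.Bool using (Bool; true; false; if_then_else_; _∧_; not)
import Data.Bool.Properties as Bool
import Data.Fin as Fin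
open import Data.Fin using (Fin; _≟_; punchIn)
open import Data.Fin.Properties using (any?; punchInᵢ≢i)
open import Data.Fin.Subset using (Subset; _∈_; _∉_; _⊆_; ⁅_⁆; ∣_∣)
open import Data.Fin.Subset.Properties
  using (_∈?_; _⊂?_; p⊂q⇒∣p∣<∣q∣; ∣p∣≤n; x∈⁅x⁆; x∈⁅y⁆⇒x≡y; ⊆-antisym)
import Data.Integer as ℤ using (_+_; _-_)
import Data.Integer.Properties as ℤ using (+-injective; pos-+)
open import Data.Integer.Tactic.RingSolver using (solve-∀)
open import Data.List using (List; []; _∷_; _++_; [_]; tabulate; map; allFin)
open import Data.List.Properties using (map-tabulate)
open import Data.List.Membership.Propositional using () renaming (_∈_ to _∈ₗ_)
open import Data.List.Membership.Propositional.Properties using (∈-++⁺ˡ; ∈-++⁺ʳ; ∈-++⁻)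
open import Data.List.Relation.Binary.Permutation.Propositional using (_↭_; ↭-sym; ↭-trans; ↭⇒↭ₛ)
open import Data.List.Relation.Binary.Permutation.Propositional.Properties using (∈-resp-↭; ++-comm; shifts)
import Data.List.Relation.Binary.Permutation.Setoid.Properties as Permutationₛ
import Data.List.Relation.Unary.All as All
open import Data.List.Relation.Unary.AllPairs using ([]; _∷_)
open import Data.List.Relation.Unary.Any using (here; there)
open import Data.List.Relation.Unary.Unique.Propositional using (Unique)
import Data.List.Relation.Unary.Unique.Propositional.Properties as Unique
open import Data.Nat using (ℕ; zero; suc; _+_; _*_; _≤_; _<_)
open import Data.Nat.Induction using (<-wellFounded)
import Data.Nat.ListAction as List
open import Data.Nat.Properties
  using ( +-identityʳ; +-comm; +-cancelʳ-≡; +-monoʳ-<; *-identityˡ; *-identityʳ; *-comm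
        ; ≤-refl; ≤-reflexive; ≤-trans; <⇒≤; <⇒≢; <⇒≱; ≤-<-trans; <-≤-trans; m≤n+m; m≤m+n
        ; +-0-commutativeMonoid; +-commutativeSemigroup )
open import Algebra.Properties.CommutativeMonoid.Sum +-0-commutativeMonoid
  using (sum; sum-syntax; sum-cong-≗; ∑-distrib-+; sum-remove; sum-replicate-zero)
open import Algebra.Properties.CommutativeSemigroup +-commutativeSemigroup using (xy∙z≈xz∙y)
open import Data.Product using (_×_; _,_; proj₁; proj₂; ∃; ∃-syntax; Σ-syntax)
open import Data.Sum using (_⊎_; inj₁; inj₂; [_,_]′)
import Data.Sum as Sum
open import Data.Vec as Vec using ()
open import Data.Vec.Properties using (lookup∘tabulate; []=⇒lookup; lookup⇒[]=)
open import Function using (_∘_; id)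
open import Function.Bundles using (_⇔_; mk⇔; Equivalence)
open import Induction.WellFounded using (Acc; acc)
open import Relation.Binary.Construct.Closure.ReflexiveTransitive as Star using (Star; ε; _◅_; _◅◅_)
open import Relation.Binary.PropositionalEquality
  using (_≡_; _≢_; refl; sym; trans; cong; cong₂; subst; setoid; module ≡-Reasoning)
open import Relation.Nullary using (¬_; does; yes; no; contradiction)
open import Relation.Nullary.Decidable using (dec-true; dec-false; _×-dec_; _⊎-dec_)
open import Relation.Unary using (Decidable)

open Equivalence using (to; from)

private variable
  n : ℕ
  R : Graph n
  a b p q u v x y : Fin n

𝟙 : Bool → ℕ
𝟙 b = if b then 1 else 0

δ : Fin n → Fin n → ℕ
δ x y = 𝟙 (does (x ≟ y))

δ-refl : (x : Fin n) → δ x x ≡ 1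
δ-refl x rewrite dec-true (x ≟ x) refl = refl

δ-≢ : x ≢ y → δ x y ≡ 0
δ-≢ {x = x} {y} x≢y rewrite dec-false (x ≟ y) x≢y = refl

∑-zero : ∀ {n} {f : Fin n → ℕ} → (∀ i → f i ≡ 0) → sum f ≡ 0
∑-zero {n} f≗0 = trans (sum-cong-≗ f≗0) (sum-replicate-zero n)

∑-δ : (a : Fin n) (c : ℕ) → ∑[ u < n ] (δ u a * c) ≡ c
∑-δ {suc n} a c = begin
  sum f                     ≡⟨ sum-remove {i = a} f ⟩
  f a + sum (f ∘ punchIn a) ≡⟨ cong₂ _+_ (cong (_* c) (δ-refl a)) (∑-zero off-a) ⟩
  1 * c + 0                 ≡⟨ trans (+-identityʳ _) (*-identityˡ c) ⟩
  c                         ∎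
  where
  open ≡-Reasoning
  f : Fin (suc n) → ℕ
  f u = δ u a * c
  off-a : ∀ i → f (punchIn a i) ≡ 0
  off-a i = cong (_* c) (δ-≢ (punchInᵢ≢i a i))

∑-allFin : (f : Fin n → ℕ) → List.sum (map f (allFin n)) ≡ ∑[ i < n ] f i
∑-allFin f = trans (cong List.sum (map-tabulate id f)) (sum-tabulate f)
  where
  sum-tabulate : ∀ {n} (f : Fin n → ℕ) → List.sum (tabulate f) ≡ sum f
  sum-tabulate {zero}  f = refl
  sum-tabulate {suc n} f = cong (f _ +_) (sum-tabulate (f ∘ Fin.suc))

indeg outdeg : Graph n → Fin n → ℕ
indeg  {n} R v = ∑[ u < n ] Wval R u v
outdeg {n} R v = ∑[ w < n ] Wval R v w

size : Graph n → ℕ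
size {n} R = ∑[ u < n ] outdeg R u

removeEdge : Graph n → Fin n → Fin n → Graph n
removeEdge R a b u v = R u v ∧ not (does (u ≟ a) ∧ does (v ≟ b))

∧-not≡true : ∀ {x y} → (x ∧ not y) ≡ true ⇔ (x ≡ true × y ≡ false)
∧-not≡true {true}  {false} = mk⇔ (λ _ → refl , refl) (λ _ → refl)
∧-not≡true {true}  {true}  = mk⇔ (λ ()) (λ ())
∧-not≡true {false}         = mk⇔ (λ ()) (λ ())

edge-≟-false : (does (u ≟ a) ∧ does (v ≟ b)) ≡ false ⇔ (¬ (u ≡ a × v ≡ b))
edge-≟-false {u = u} {a = a} {v = v} {b = b} = mk⇔ ⇒ ⇐
  where
  ⇒ : (does (u ≟ a) ∧ does (v ≟ b)) ≡ false → ¬ (u ≡ a × v ≡ b)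
  ⇒ h (refl , refl) rewrite dec-true (u ≟ u) refl | dec-true (v ≟ v) refl = contradiction h λ ()
  ⇐ : ¬ (u ≡ a × v ≡ b) → (does (u ≟ a) ∧ does (v ≟ b)) ≡ false
  ⇐ ne with u ≟ a | v ≟ b
  ... | yes u≡a | yes v≡b = contradiction (u≡a , v≡b) ne
  ... | yes _   | no _    = refl
  ... | no _    | _       = refl

Adj-removeEdge : ∀ (R : Graph n) a b u v → Adj (removeEdge R a b) u v ⇔ (Adj R u v × ¬ (u ≡ a × v ≡ b))
Adj-removeEdge _ _ _ _ _ = mk⇔ (λ h → let r , e = to ∧-not≡true h in r , to edge-≟-false e)
                     (λ (r , ne) → from ∧-not≡true (r , from edge-≟-false ne))

𝟙-split : ∀ r x y → (x ≡ true → y ≡ true → r ≡ true) → 𝟙 r ≡ 𝟙 (r ∧ not (x ∧ y)) + 𝟙 x * 𝟙 y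
𝟙-split false true  true  h = contradiction (h refl refl) λ ()
𝟙-split false true  false _ = refl
𝟙-split false false _     _ = refl
𝟙-split true  true  true  _ = refl
𝟙-split true  true  false _ = refl
𝟙-split true  false _     _ = refl

Wval-removeEdge : Adj R a b → ∀ u v → Wval R u v ≡ Wval (removeEdge R a b) u v + δ u a * δ v b
Wval-removeEdge {R = R} {a} {b} hab u v = 𝟙-split (R u v) (does (u ≟ a)) (does (v ≟ b)) at-ab
  where
  at-ab : does (u ≟ a) ≡ true → does (v ≟ b) ≡ true → R u v ≡ true
  at-ab with u ≟ a | v ≟ b
  ... | yes refl | yes refl = λ _ _ → hab
  ... | yes _    | no _     = λ _ ()
  ... | no _     | _        = λ ()

indeg-removeEdge : Adj R a b → ∀ v → indeg R v ≡ indeg (removeEdge R a b) v + δ v b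
indeg-removeEdge {R = R} {a} {b} hab v = begin
  indeg R v                                       ≡⟨ sum-cong-≗ (λ u → Wval-removeEdge {R = R} hab u v) ⟩
  sum (λ u → Wval R′ u v + δ u a * δ v b)         ≡⟨ ∑-distrib-+ (λ u → Wval R′ u v) _ ⟩
  indeg R′ v + sum (λ u → δ u a * δ v b)          ≡⟨ cong (indeg R′ v +_) (∑-δ a (δ v b)) ⟩
  indeg R′ v + δ v b                              ∎
  where open ≡-Reasoning; R′ = removeEdge R a b

outdeg-removeEdge : Adj R a b → ∀ v → outdeg R v ≡ outdeg (removeEdge R a b) v + δ v a
outdeg-removeEdge {R = R} {a} {b} hab v = begin
  outdeg R v                                      ≡⟨ sum-cong-≗ (Wval-removeEdge {R = R} hab v) ⟩
  sum (λ w → Wval R′ v w + δ v a * δ w b)         ≡⟨ ∑-distrib-+ (Wval R′ v) _ ⟩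
  outdeg R′ v + sum (λ w → δ v a * δ w b)         ≡⟨ cong (outdeg R′ v +_) (sum-cong-≗ λ w → *-comm (δ v a) (δ w b)) ⟩
  outdeg R′ v + sum (λ w → δ w b * δ v a)         ≡⟨ cong (outdeg R′ v +_) (∑-δ b (δ v a)) ⟩
  outdeg R′ v + δ v a                             ∎
  where open ≡-Reasoning; R′ = removeEdge R a b

size-removeEdge : Adj R a b → size (removeEdge R a b) < size R
size-removeEdge {R = R} {a} {b} hab = ≤-reflexive (sym (begin
  size R                                  ≡⟨ sum-cong-≗ (outdeg-removeEdge {R = R} hab) ⟩
  sum (λ u → outdeg R′ u + δ u a)         ≡⟨ ∑-distrib-+ (outdeg R′) _ ⟩
  size R′ + sum (λ u → δ u a)              ≡⟨ cong (size R′ +_) (sum-cong-≗ λ u → sym (*-identityʳ (δ u a))) ⟩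
  size R′ + sum (λ u → δ u a * 1)          ≡⟨ cong (size R′ +_) (∑-δ a 1) ⟩
  size R′ + 1                             ≡⟨ +-comm (size R′) 1 ⟩
  suc (size R′)                           ∎))
  where open ≡-Reasoning; R′ = removeEdge R a b

PathBalanced : Graph n → Fin n → Fin n → Set
PathBalanced R p q = ∀ v → indeg R v + δ v p ≡ outdeg R v + δ v q

Balanced : Graph n → Set
Balanced R = ∀ v → indeg R v ≡ outdeg R v

Balanced⇔PathBalanced : ∀ q → Balanced R ⇔ PathBalanced R q q
Balanced⇔PathBalanced q = mk⇔ (λ bal v → cong (_+ δ v q) (bal v)) (λ bal v → +-cancelʳ-≡ (δ v q) _ _ (bal v))

PathBalanced-removeEdge : Adj R a b → PathBalanced R a q ⇔ PathBalanced (removeEdge R a b) b q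
PathBalanced-removeEdge {R = R} {a} {b} {q} hab = mk⇔ (λ bal v → to (at v) (bal v)) (λ bal v → from (at v) (bal v))
  where
  R′ = removeEdge R a b
  at : ∀ v → (indeg R v + δ v a ≡ outdeg R v + δ v q) ⇔ (indeg R′ v + δ v b ≡ outdeg R′ v + δ v q)
  at v rewrite indeg-removeEdge {R = R} hab v | outdeg-removeEdge {R = R} hab v = mk⇔
    (λ eq → +-cancelʳ-≡ (δ v a) _ _ (trans eq (xy∙z≈xz∙y (outdeg R′ v) (δ v a) (δ v q))))
    (λ eq → trans (cong (_+ δ v a) eq) (xy∙z≈xz∙y (outdeg R′ v) (δ v q) (δ v a)))

∅ : Graph n
∅ _ _ = false

Bool-≡-from-⇔ : ∀ {x y} → (x ≡ true ⇔ y ≡ true) → x ≡ y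
Bool-≡-from-⇔ {false} {false} _ = refl
Bool-≡-from-⇔ {false} {true}  e = from e refl
Bool-≡-from-⇔ {true}          e = sym (to e refl)

record Partition (R : Graph n) (es : List (Edge n)) (R′ : Graph n) : Set where
  field
    unique   : Unique es
    split    : ∀ u v → Adj R u v ⇔ ((u , v) ∈ₗ es ⊎ Adj R′ u v)
    disjoint : ∀ {u v} → (u , v) ∈ₗ es → ¬ Adj R′ u v

  listed⇒Adj : (u , v) ∈ₗ es → Adj R u v
  listed⇒Adj m = from (split _ _) (inj₁ m)

  rest⇒Adj : Adj R′ u v → Adj R u v
  rest⇒Adj h = from (split _ _) (inj₂ h)

open Partition

Partition-refl : Partition R [] R
Partition-refl = record
  { unique   = []
  ; split    = λ _ _ → mk⇔ inj₂ [ (λ ()) , id ]′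
  ; disjoint = λ ()
  }

Partition-removeEdge : Adj R a b → Partition R [ (a , b) ] (removeEdge R a b)
Partition-removeEdge {R = R} {a} {b} hab = record
  { unique   = All.[] ∷ []
  ; split    = λ u v → mk⇔ (⇒ u v) ⇐
  ; disjoint = λ { (here refl) h → proj₂ (to (Adj-removeEdge R a b a b) h) (refl , refl) }
  }
  where
  ⇒ : ∀ u v → Adj R u v → (u , v) ∈ₗ [ (a , b) ] ⊎ Adj (removeEdge R a b) u v
  ⇒ u v h with (u ≟ a) ×-dec (v ≟ b)
  ... | yes (refl , refl) = inj₁ (here refl)
  ... | no ne             = inj₂ (from (Adj-removeEdge R a b u v) (h , ne))
  ⇐ : (u , v) ∈ₗ [ (a , b) ] ⊎ Adj (removeEdge R a b) u v → Adj R u v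
  ⇐ (inj₁ (here refl)) = hab
  ⇐ {u = u} {v} (inj₂ h) = proj₁ (to (Adj-removeEdge R a b u v) h)

Partition-++ : ∀ {R₁ R₂ : Graph n} {T C} → Partition R T R₁ → Partition R₁ C R₂ → Partition R (T ++ C) R₂
Partition-++ {R = R} {R₂ = R₂} {T} {C} P Q = record
  { unique   = Unique.++⁺ (unique P) (unique Q) λ { {_ , _} (mT , mC) → disjoint P mT (listed⇒Adj Q mC) }
  ; split    = λ u v → mk⇔ ⇒ ⇐
  ; disjoint = disj
  }
  where
  ⇒ : Adj R u v → (u , v) ∈ₗ T ++ C ⊎ Adj R₂ u v
  ⇒ h with to (split P _ _) h
  ... | inj₁ mT = inj₁ (∈-++⁺ˡ mT)
  ... | inj₂ h₁ with to (split Q _ _) h₁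
  ...   | inj₁ mC = inj₁ (∈-++⁺ʳ T mC)
  ...   | inj₂ h₂ = inj₂ h₂
  ⇐ : (u , v) ∈ₗ T ++ C ⊎ Adj R₂ u v → Adj R u v
  ⇐ (inj₁ m) with ∈-++⁻ T m
  ... | inj₁ mT = listed⇒Adj P mT
  ... | inj₂ mC = rest⇒Adj P (listed⇒Adj Q mC)
  ⇐ (inj₂ h₂) = rest⇒Adj P (rest⇒Adj Q h₂)
  disj : (u , v) ∈ₗ T ++ C → ¬ Adj R₂ u v
  disj m h₂ with ∈-++⁻ T m
  ... | inj₁ mT = disjoint P mT (rest⇒Adj Q h₂)
  ... | inj₂ mC = disjoint Q mC h₂

Partition-↭ : ∀ {R′ : Graph n} {T T′} → T ↭ T′ → Partition R T R′ → Partition R T′ R′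
Partition-↭ {n = n} T↭T′ P = record
  { unique   = Unique-resp-↭ (↭⇒↭ₛ T↭T′) (unique P)
  ; split    = λ u v → mk⇔ (Sum.map₁ (∈-resp-↭ T↭T′) ∘ to (split P u v))
                             (from (split P u v) ∘ Sum.map₁ (∈-resp-↭ (↭-sym T↭T′)))
  ; disjoint = disjoint P ∘ ∈-resp-↭ (↭-sym T↭T′)
  }
  where open Permutationₛ (setoid (Edge n)) using (Unique-resp-↭)

Partition-uncons : ∀ {R′ : Graph n} {es} → Partition R ((a , b) ∷ es) R′ → Adj R a b × Partition (removeEdge R a b) es R′
Partition-uncons {R = R} {a} {b} {R′} {es} P with unique P
... | head-fresh ∷ tail-unique = listed⇒Adj P (here refl) , record
  { unique   = tail-unique
  ; split    = λ u v → mk⇔ ⇒ ⇐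
  ; disjoint = disjoint P ∘ there
  }
  where
  ⇒ : Adj (removeEdge R a b) u v → (u , v) ∈ₗ es ⊎ Adj R′ u v
  ⇒ {u = u} {v = v} h with to (Adj-removeEdge R a b u v) h
  ... | h′ , ne with to (split P u v) h′
  ...   | inj₁ (here refl)  = contradiction (refl , refl) ne
  ...   | inj₁ (there m)    = inj₁ m
  ...   | inj₂ r            = inj₂ r
  ⇐ : (u , v) ∈ₗ es ⊎ Adj R′ u v → Adj (removeEdge R a b) u v
  ⇐ {u = u} {v} (inj₁ m) = from (Adj-removeEdge R a b u v)
    (listed⇒Adj P (there m) , λ { (refl , refl) → All.lookup head-fresh m refl })
  ⇐ {u = u} {v} (inj₂ r) = from (Adj-removeEdge R a b u v)
    (rest⇒Adj P r , λ { (refl , refl) → disjoint P (here refl) r })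

Partition-[]-Balanced : ∀ {R′ : Graph n} → Partition R [] R′ → Balanced R′ → Balanced R
Partition-[]-Balanced {R = R} {R′} P bal v = begin
  indeg R v   ≡⟨ sum-cong-≗ (λ u → cong 𝟙 (same u v)) ⟩
  indeg R′ v  ≡⟨ bal v ⟩
  outdeg R′ v ≡⟨ sum-cong-≗ (λ w → cong 𝟙 (sym (same v w))) ⟩
  outdeg R v  ∎
  where
  open ≡-Reasoning
  same : ∀ u v → R u v ≡ R′ u v
  same u v = Bool-≡-from-⇔ (mk⇔ (λ h → [ (λ ()) , id ]′ (to (split P u v) h)) (from (split P u v) ∘ inj₂))

Partition-edgeless : ∀ {R′ : Graph n} {es} → (∀ u v → ¬ Adj R′ u v) → Partition R es R′ → Partition R es ∅
Partition-edgeless no-edges P = record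
  { unique   = unique P
  ; split    = λ u v → mk⇔ (Sum.map₂ (λ h → contradiction h (no-edges u v)) ∘ to (split P u v))
                             (from (split P u v) ∘ Sum.map₂ λ ())
  ; disjoint = λ _ ()
  }

Partition-∅-listed : ∀ {es} → Partition R es ∅ → Adj R u v → (u , v) ∈ₗ es
Partition-∅-listed P h = [ id , (λ ()) ]′ (to (split P _ _) h)

data Walk : Fin n → List (Edge n) → Fin n → Set where
  nil  : Walk x [] x
  cons : ∀ {es} → Walk y es q → Walk x ((x , y) ∷ es) q

Walk-++ : ∀ {A B} → Walk p A x → Walk x B q → Walk p (A ++ B) q
Walk-++ nil      w = w
Walk-++ (cons v) w = cons (Walk-++ v w)

Walk⇒Star : ∀ {R : Graph n} {es} → Walk p es q → (∀ {u v} → (u , v) ∈ₗ es → Adj R u v) → Star (Adj R) p q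
Walk⇒Star nil      _  = ε
Walk⇒Star (cons w) on = on (here refl) ◅ Walk⇒Star w (on ∘ there)

WalkEdges⇒Walk : ∀ {es} → WalkEdges p es q → Walk p es q
WalkEdges⇒Walk single   = cons nil
WalkEdges⇒Walk (cons w) = cons (WalkEdges⇒Walk w)

Walk⇒WalkEdges : ∀ {es} → p ≢ q → Walk p es q → WalkEdges p es q
Walk⇒WalkEdges p≢q nil      = contradiction refl p≢q
Walk⇒WalkEdges _   (cons w) = edge∷ w
  where
  edge∷ : ∀ {es} → Walk y es q → WalkEdges x ((x , y) ∷ es) q
  edge∷ nil      = single
  edge∷ (cons w) = cons (edge∷ w)

Walk-suffix : ∀ {es} → Walk p es q → (u , v) ∈ₗ es →
              ∃[ B ] Walk v B q × (∀ {e} → e ∈ₗ (u , v) ∷ B → e ∈ₗ es)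
Walk-suffix (cons w) (here refl) = _ , w , id
Walk-suffix (cons w) (there m) =
  let B , w′ , ⊆es = Walk-suffix w m in B , w′ , there ∘ ⊆es

Walk-from : ∀ {es} → Walk p es q → ∃[ y ] ((x , y) ∈ₗ es ⊎ (y , x) ∈ₗ es) →
            ∃[ B ] Walk x B q × (∀ {e} → e ∈ₗ B → e ∈ₗ es)
Walk-from w (y , inj₁ m) = let B , w′ , ⊆es = Walk-suffix w m in _ , cons w′ , ⊆es
Walk-from w (y , inj₂ m) = let B , w′ , ⊆es = Walk-suffix w m in B , w′ , ⊆es ∘ there

Walk-exit : ∀ {C : Subset n} {es} → Walk x es y → x ∈ C → y ∉ C →
            ∃[ u ] ∃[ v ] (u , v) ∈ₗ es × u ∈ C × v ∉ C
Walk-exit nil      x∈C y∉C = contradiction x∈C y∉C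
Walk-exit {C = C} (cons {y = z} w) x∈C y∉C with z ∈? C
... | no z∉C = _ , z , here refl , x∈C , z∉C
... | yes z∈C = let u , v , m , u∈C , v∉C = Walk-exit w z∈C y∉C in u , v , there m , u∈C , v∉C

Walk-source-NodeH : ∀ {R R′ : Graph n} {es} → p ≢ q → Walk p es q → Partition R es R′ → NodeH R p
Walk-source-NodeH p≢q nil      _ = contradiction refl p≢q
Walk-source-NodeH _   (cons _) P = _ , inj₁ (listed⇒Adj P (here refl))

Walk-PathBalanced : ∀ {R R′ : Graph n} {es} → Walk p es q → Partition R es R′ → Balanced R′ → PathBalanced R p q
Walk-PathBalanced {p = p} nil      P bal = to (Balanced⇔PathBalanced p) (Partition-[]-Balanced P bal)
Walk-PathBalanced         (cons w) P bal =
  let hab , P′ = Partition-uncons P in from (PathBalanced-removeEdge hab) (Walk-PathBalanced w P′ bal)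

-- Greedy trails in balanced graphs

out-edge : 0 < outdeg R v → ∃ (Adj R v)
out-edge {R = R} {v} 0<out with any? (λ w → R v w Bool.≟ true)
... | yes found = found
... | no none   = contradiction (sym no-out) (<⇒≢ 0<out)
  where
  no-out : outdeg R v ≡ 0
  no-out = ∑-zero (λ w → cong 𝟙 (Bool.¬-not (λ h → none (w , h))))

PathBalanced-out : p ≢ q → PathBalanced R p q → 0 < outdeg R p
PathBalanced-out {p = p} {q} {R} p≢q bal = subst (0 <_) (begin
  indeg R p + 1       ≡⟨ cong (indeg R p +_) (sym (δ-refl p)) ⟩
  indeg R p + δ p p   ≡⟨ bal p ⟩
  outdeg R p + δ p q  ≡⟨ cong (outdeg R p +_) (δ-≢ p≢q) ⟩
  outdeg R p + 0      ≡⟨ +-identityʳ _ ⟩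
  outdeg R p          ∎) (m≤n+m 1 (indeg R p))
  where open ≡-Reasoning

Balanced-out : Balanced R → Adj R x y → ∃ (Adj R y)
Balanced-out {R = R} {x} {y} bal h = out-edge {R = R} (subst (0 <_) (begin
  indeg (removeEdge R x y) y + 1    ≡⟨ cong (indeg (removeEdge R x y) y +_) (sym (δ-refl y)) ⟩
  indeg (removeEdge R x y) y + δ y y ≡⟨ sym (indeg-removeEdge {R = R} h y) ⟩
  indeg R y                          ≡⟨ bal y ⟩
  outdeg R y                         ∎) (m≤n+m 1 _))
  where open ≡-Reasoning

record Decomposition (R : Graph n) (p q : Fin n) : Set where
  field
    trail     : List (Edge n)
    rest      : Graph n
    walk      : Walk p trail q
    partition : Partition R trail rest
    balanced  : Balanced rest
    shrinks   : size rest ≤ size R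

open Decomposition

Decomposition-∷ : Adj R p x → Decomposition (removeEdge R p x) x q → Decomposition R p q
Decomposition-∷ {R = R} h D = record
  { trail     = _ ∷ trail D
  ; rest      = rest D
  ; walk      = cons (walk D)
  ; partition = Partition-++ (Partition-removeEdge h) (partition D)
  ; balanced  = balanced D
  ; shrinks   = ≤-trans (shrinks D) (<⇒≤ (size-removeEdge {R = R} h))
  }

decompose : PathBalanced R p q → Decomposition R p q
decompose = go (<-wellFounded _)
  where
  go : Acc _<_ (size R) → PathBalanced R p q → Decomposition R p q
  go {p = p} {q} _ bal with p ≟ q
  ... | yes refl = record
    { trail     = []
    ; rest      = _
    ; walk      = nil
    ; partition = Partition-refl
    ; balanced  = from (Balanced⇔PathBalanced p) bal
    ; shrinks   = ≤-refl
    }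
  go {R = R} (acc smaller) bal | no p≢q with out-edge {R = R} (PathBalanced-out {R = R} p≢q bal)
  ... | _ , h = Decomposition-∷ h (go (smaller (size-removeEdge {R = R} h)) (to (PathBalanced-removeEdge h) bal))

closedTrail : Balanced R → Adj R p x → Σ[ D ∈ Decomposition R p p ] size (rest D) < size R
closedTrail {R = R} {p} bal h = Decomposition-∷ h D , ≤-<-trans (shrinks D) (size-removeEdge {R = R} h)
  where D = decompose (to (PathBalanced-removeEdge h) (to (Balanced⇔PathBalanced p) bal))

Balanced-edge-reversible : Balanced R → Adj R x y → Star (Adj R) y x
Balanced-edge-reversible {R = R} {x} {y} bal h =
  Walk⇒Star (walk D) (λ m → proj₁ (to (Adj-removeEdge R x y _ _) (listed⇒Adj (partition D) m)))
  where D = decompose (to (PathBalanced-removeEdge h) (to (Balanced⇔PathBalanced x) bal))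

Balanced-Star-sym : Balanced R → Star (Adj R) x y → Star (Adj R) y x
Balanced-Star-sym bal ε       = ε
Balanced-Star-sym bal (h ◅ p) = Balanced-Star-sym bal p ◅◅ Balanced-edge-reversible bal h

decSubset : {P : Fin n → Set} → Decidable P → Subset n
decSubset P? = Vec.tabulate (does ∘ P?)

∈-decSubset : {P : Fin n → Set} (P? : Decidable P) → x ∈ decSubset P? ⇔ P x
∈-decSubset {x = x} P? = mk⇔ ⇒ ⇐
  where
  ⇒ : x ∈ decSubset P? → _
  ⇒ m with P? x | trans (sym (lookup∘tabulate (does ∘ P?) x)) ([]=⇒lookup m)
  ... | yes px | _ = px
  ... | no _   | ()
  ⇐ : _ → x ∈ decSubset P?
  ⇐ px = lookup⇒[]= x _ (trans (lookup∘tabulate (does ∘ P?) x) (dec-true (P? x) px))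

expansion? : (R : Graph n) (S : Subset n) → Decidable λ v → v ∈ S ⊎ ∃[ u ] u ∈ S × Adj R u v
expansion? R S v = v ∈? S ⊎-dec any? λ u → u ∈? S ×-dec R u v Bool.≟ true

expand : Graph n → Subset n → Subset n
expand R S = decSubset (expansion? R S)

∈-expand : (R : Graph n) (S : Subset n) → v ∈ expand R S ⇔ (v ∈ S ⊎ ∃[ u ] u ∈ S × Adj R u v)
∈-expand R S = ∈-decSubset (expansion? R S)

⊆-expand : (R : Graph n) (S : Subset n) → S ⊆ expand R S
⊆-expand R S = from (∈-expand R S) ∘ inj₁

record Closure (R : Graph n) (S : Subset n) : Set where
  field
    set       : Subset n
    seed⊆     : S ⊆ set
    closed    : u ∈ set → Adj R u v → v ∈ set
    reachable : v ∈ set → ∃[ u ] u ∈ S × Star (Adj R) u v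

closure : ∀ {n} (R : Graph n) (S : Subset n) → Closure R S
closure {n} R S = saturate (suc n) S (m≤m+n (suc n) ∣ S ∣)
  where
  -- Every round that does not stop enlarges S, and ∣ S ∣ ≤ n, so the fuel k never runs out.
  saturate : ∀ k S → n < k + ∣ S ∣ → Closure R S
  saturate k S bound with S ⊂? expand R S
  ... | no ¬grows = record
    { set       = S
    ; seed⊆     = id
    ; closed    = λ uS e → stable (from (∈-expand R S) (inj₂ (_ , uS , e)))
    ; reachable = λ vS → _ , vS , ε
    }
    where
    stable : expand R S ⊆ S
    stable {v} m with v ∈? S
    ... | yes vS = vS
    ... | no v∉S = contradiction ((λ {x} → ⊆-expand R S {x}) , v , m , v∉S) ¬grows
  saturate zero    S bound | yes _     = contradiction (∣p∣≤n S) (<⇒≱ bound)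
  saturate (suc k) S bound | yes grows = record
    { set       = Closure.set C
    ; seed⊆     = Closure.seed⊆ C ∘ ⊆-expand R S
    ; closed    = Closure.closed C
    ; reachable = λ vC → back (Closure.reachable C vC)
    }
    where
    C = saturate k (expand R S) (<-≤-trans bound (+-monoʳ-< k (p⊂q⇒∣p∣<∣q∣ grows)))
    back : ∃[ u ] u ∈ expand R S × Star (Adj R) u v → ∃[ u ] u ∈ S × Star (Adj R) u v
    back (u , m , path) with to (∈-expand R S) m
    ... | inj₁ uS             = u , uS , path
    ... | inj₂ (w , wS , e)   = w , wS , e ◅ path

-- Opaque, so that reachableFrom is only used through ∈-reachableFrom and its
-- arguments remain inferable from membership proofs.
opaque
  reachableFrom : Graph n → Fin n → Subset n
  reachableFrom R a = Closure.set (closure R ⁅ a ⁆)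

  ∈-reachableFrom : v ∈ reachableFrom R a ⇔ Star (Adj R) a v
  ∈-reachableFrom {v = v} {R = R} {a} = mk⇔ ⇒ (along (Closure.seed⊆ C (x∈⁅x⁆ a)))
    where
    C : Closure R ⁅ a ⁆
    C = closure R ⁅ a ⁆
    ⇒ : v ∈ reachableFrom R a → Star (Adj R) a v
    ⇒ m with Closure.reachable C m
    ... | u , u∈⁅a⁆ , path rewrite x∈⁅y⁆⇒x≡y a u∈⁅a⁆ = path
    along : x ∈ Closure.set C → Star (Adj R) x y → y ∈ Closure.set C
    along m ε       = m
    along m (e ◅ p) = along (Closure.closed C m e) p

-- Strongly connected components of H

module _ {W : Graph n} where

  singleton-stronglyConnected : NodeH W x → StronglyConnectedSet W ⁅ x ⁆
  singleton-stronglyConnected {x} x∈H = (λ y m → subst (NodeH W) (sym (x∈⁅y⁆⇒x≡y x m)) x∈H) , pairs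
    where
    pairs : ∀ y z → y ∈ ⁅ x ⁆ → z ∈ ⁅ x ⁆ → ReachH W y z × ReachH W z y
    pairs y z m m′ rewrite x∈⁅y⁆⇒x≡y x m | x∈⁅y⁆⇒x≡y x m′ = ε , ε

  IsSCC-nonempty : ∀ {C} → NodeH W x → IsSCC W C → ∃ (_∈ C)
  IsSCC-nonempty {x} {C} x∈H (_ , maximal) with any? (_∈? C)
  ... | yes found = found
  ... | no none   = x , maximal ⁅ x ⁆ (λ {y} y∈C → contradiction (y , y∈C) none)
                                    (singleton-stronglyConnected x∈H) (x∈⁅x⁆ x)

  sink-SCC : ∀ {t C} → (∀ v → ¬ Adj W t v) → StronglyConnectedSet W C → t ∈ C → C ≡ ⁅ t ⁆
  sink-SCC {t} {C} sink (_ , pairs) t∈C = ⊆-antisym (λ {y} y∈C → stuck (proj₁ (pairs t y t∈C y∈C)))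
                                                    (λ m → subst (_∈ C) (sym (x∈⁅y⁆⇒x≡y t m)) t∈C)
    where
    stuck : ReachH W t y → y ∈ ⁅ t ⁆
    stuck ε       = x∈⁅x⁆ t
    stuck (h ◅ _) = contradiction h (sink _)

module _ {W R : Graph n} (R⊆W : ∀ {u v} → Adj R u v → Adj W u v) (bal : Balanced R)
         (R-closed : ∀ {x y} → ∃ (Adj R x) → Adj W x y → Adj R x y) where

  Star-restrict : ∃ (Adj R x) → Star (Adj W) x y → Star (Adj R) x y × ∃ (Adj R y)
  Star-restrict out ε       = ε , out
  Star-restrict out (h ◅ p) =
    let h′ = R-closed out h ; p′ , out′ = Star-restrict (Balanced-out bal h′) p in h′ ◅ p′ , out′

  reachableFrom-IsSCC : ∃ (Adj R a) → IsSCC W (reachableFrom W a)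
  reachableFrom-IsSCC {a} out = (node , pairs) , maximal
    where
    from-a : y ∈ reachableFrom W a → Star (Adj R) a y × ∃ (Adj R y)
    from-a = Star-restrict out ∘ to ∈-reachableFrom
    node : ∀ y → y ∈ reachableFrom W a → NodeH W y
    node y m = let _ , (w , h) = from-a m in w , inj₁ (R⊆W h)
    via-a : ∀ {x y} → x ∈ reachableFrom W a → y ∈ reachableFrom W a → ReachH W x y
    via-a mx my = Star.map R⊆W (Balanced-Star-sym bal (proj₁ (from-a mx)) ◅◅ proj₁ (from-a my))
    pairs : ∀ x y → x ∈ reachableFrom W a → y ∈ reachableFrom W a → ReachH W x y × ReachH W y x
    pairs _ _ mx my = via-a mx my , via-a my mx
    maximal : ∀ D → reachableFrom W a ⊆ D → StronglyConnectedSet W D → D ⊆ reachableFrom W a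
    maximal D C⊆D (_ , pairsD) y∈D =
      from ∈-reachableFrom (proj₁ (pairsD a _ (C⊆D (from ∈-reachableFrom ε)) y∈D))

untouched-rest-edgeless : ∀ {E W R : Graph n} {t T} → Condition2 E W t → (∀ v → ¬ Adj W t v) →
                          Partition W T R → Balanced R →
                          (∀ {u v} → (u , v) ∈ₗ T → ∀ w → ¬ Adj R u w) → ¬ Adj R a b
untouched-rest-edgeless {a = a} {b} {E} {W} {R} {t} c2 sink P bal untouched hab =
  no-exit (c2 C (reachableFrom-IsSCC (rest⇒Adj P) bal R-closed (b , hab)) C≢⁅t⁆)
  where
  C = reachableFrom W a
  R-closed : ∀ {x y} → ∃ (Adj R x) → Adj W x y → Adj R x y
  R-closed (w , out) h with to (split P _ _) h
  ... | inj₁ m = contradiction out (untouched m w)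
  ... | inj₂ r = r
  C≢⁅t⁆ : C ≢ ⁅ t ⁆
  C≢⁅t⁆ C≡⁅t⁆ with x∈⁅y⁆⇒x≡y t (subst (a ∈_) C≡⁅t⁆ (from ∈-reachableFrom ε))
  ... | refl = sink b (rest⇒Adj P hab)
  no-exit : ¬ LeavingWEdge E W C
  no-exit (u , v , _ , h , u∈C , v∉C) = v∉C (from ∈-reachableFrom (to ∈-reachableFrom u∈C ◅◅ (h ◅ ε)))

-- Splicing closed trails

record Branch (R : Graph n) (p : Fin n) (es : List (Edge n)) (q : Fin n) : Set where
  field
    before after : List (Edge n)
    node         : Fin n
    splits       : es ≡ before ++ after
    walk-before  : Walk p before node
    walk-after   : Walk node after q
    branches     : ∃ (Adj R node)

open Branch

findBranch : ∀ {R : Graph n} {es} → Walk p es q →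
             Branch R p es q ⊎ (∀ {u v} → (u , v) ∈ₗ es → ∀ w → ¬ Adj R u w)
findBranch nil = inj₂ λ ()
findBranch {p = p} {R = R} (cons w) with any? (λ x → R p x Bool.≟ true)
... | yes out = inj₁ record
  { before = [] ; after = _ ; node = p ; splits = refl ; walk-before = nil ; walk-after = cons w ; branches = out }
... | no none with findBranch w
...   | inj₁ b = inj₁ record
  { before = _ ∷ before b ; after = after b ; node = node b ; splits = cong (_ ∷_) (splits b)
  ; walk-before = cons (walk-before b) ; walk-after = walk-after b ; branches = branches b }
...   | inj₂ untouched = inj₂ λ { (here refl) x h → none (x , h) ; (there m) → untouched m }

splice : (D : Decomposition R p q) → Branch (rest D) p (trail D) q →
         Σ[ D′ ∈ Decomposition R p q ] size (rest D′) < size (rest D)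
splice D b with closedTrail (balanced D) (proj₂ (branches b))
... | C , smaller = record
  { trail     = before b ++ trail C ++ after b
  ; rest      = rest C
  ; walk      = Walk-++ (walk-before b) (Walk-++ (walk C) (walk-after b))
  ; partition = Partition-↭ reorder (Partition-++ (partition D) (partition C))
  ; balanced  = balanced C
  ; shrinks   = ≤-trans (shrinks C) (shrinks D)
  } , smaller
  where
  reorder : trail D ++ trail C ↭ before b ++ trail C ++ after b
  reorder = subst (λ T → T ++ trail C ↭ _) (sym (splits b))
    (↭-trans (++-comm (before b ++ after b) (trail C)) (↭-sym (shifts (before b) (trail C))))

eulerianTrail : ∀ {E W : Graph n} {s t} → Condition2 E W t → (∀ v → ¬ Adj W t v) →
                Decomposition W s t → ∃[ es ] Walk s es t × Partition W es ∅
eulerianTrail {W = W} {s} {t} c2 sink D = go D (<-wellFounded _)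
  where
  go : (D : Decomposition W s t) → Acc _<_ (size (rest D)) → ∃[ es ] Walk s es t × Partition W es ∅
  go D (acc smaller) with findBranch (walk D)
  ... | inj₁ b = let D′ , lt = splice D b in go D′ (smaller lt)
  ... | inj₂ untouched = trail D , walk D ,
        Partition-edgeless (λ _ _ → untouched-rest-edgeless c2 sink (partition D) (balanced D) untouched) (partition D)

trail⇒Condition2 : ∀ {E W : Graph n} {s t es} → SubEdges W E → (∀ v → ¬ Adj W t v) → s ≢ t →
                   Walk s es t → Partition W es ∅ → Condition2 E W t
trail⇒Condition2 {W = W} {s} {t} {es} W⊆E sink s≢t w P C scc@(sc , _) C≢⁅t⁆
  with IsSCC-nonempty (Walk-source-NodeH s≢t w P) scc
... | x , x∈C with t ∈? C
...   | yes t∈C = contradiction (sink-SCC sink sc t∈C) C≢⁅t⁆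
...   | no t∉C =
  let B , wB , ⊆es = Walk-from w (on-trail (proj₁ sc x x∈C))
      u , v , m , u∈C , v∉C = Walk-exit wB x∈C t∉C
      h = listed⇒Adj P (⊆es m)
  in u , v , W⊆E u v h , h , u∈C , v∉C
  where
  on-trail : NodeH W x → ∃[ y ] ((x , y) ∈ₗ es ⊎ (y , x) ∈ₗ es)
  on-trail (y , e) = y , Sum.map (Partition-∅-listed P) (Partition-∅-listed P) e

module _ where
  -- ℤ's +_ is opened only here: elsewhere it would make sections such as (m +_) ambiguous.
  open import Data.Integer using (+_)

  m-n≡o-p⇔m+p≡n+o : ∀ m n o p → (+ m ℤ.- + n ≡ + o ℤ.- + p) ⇔ (m + p ≡ n + o)
  m-n≡o-p⇔m+p≡n+o m n o p = mk⇔
    (λ eq → ℤ.+-injective (begin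
      + (m + p)                        ≡⟨ ℤ.pos-+ m p ⟩
      + m ℤ.+ + p                      ≡⟨ shuffle₁ (+ m) (+ n) (+ p) ⟩
      (+ m ℤ.- + n) ℤ.+ (+ n ℤ.+ + p)  ≡⟨ cong (ℤ._+ (+ n ℤ.+ + p)) eq ⟩
      (+ o ℤ.- + p) ℤ.+ (+ n ℤ.+ + p)  ≡⟨ shuffle₂ (+ n) (+ o) (+ p) ⟩
      + n ℤ.+ + o                      ≡⟨ ℤ.pos-+ n o ⟨
      + (n + o)                        ∎))
    (λ eq → begin
      + m ℤ.- + n                      ≡⟨ shuffle₃ (+ m) (+ n) (+ p) ⟩
      (+ m ℤ.+ + p) ℤ.- (+ n ℤ.+ + p)  ≡⟨ cong (ℤ._- (+ n ℤ.+ + p)) (ℤ.pos-+ m p) ⟨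
      + (m + p) ℤ.- (+ n ℤ.+ + p)      ≡⟨ cong (λ k → + k ℤ.- (+ n ℤ.+ + p)) eq ⟩
      + (n + o) ℤ.- (+ n ℤ.+ + p)      ≡⟨ cong (ℤ._- (+ n ℤ.+ + p)) (ℤ.pos-+ n o) ⟩
      (+ n ℤ.+ + o) ℤ.- (+ n ℤ.+ + p)  ≡⟨ shuffle₄ (+ n) (+ o) (+ p) ⟩
      + o ℤ.- + p                      ∎)
    where
    open ≡-Reasoning
    shuffle₁ : ∀ x y z → x ℤ.+ z ≡ (x ℤ.- y) ℤ.+ (y ℤ.+ z)
    shuffle₁ = solve-∀
    shuffle₂ : ∀ x y z → (y ℤ.- z) ℤ.+ (x ℤ.+ z) ≡ x ℤ.+ y
    shuffle₂ = solve-∀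
    shuffle₃ : ∀ x y z → x ℤ.- y ≡ (x ℤ.+ z) ℤ.- (y ℤ.+ z)
    shuffle₃ = solve-∀
    shuffle₄ : ∀ x y z → (x ℤ.+ y) ℤ.- (x ℤ.+ z) ≡ y ℤ.- z
    shuffle₄ = solve-∀

  demand-δ : ∀ {s t v : Fin n} → s ≢ t → demand s t v ≡ + δ v t ℤ.- + δ v s
  demand-δ {s = s} {t} {v} s≢t with v ≟ s | v ≟ t
  ... | yes refl | yes refl = contradiction refl s≢t
  ... | yes _    | no _     = refl
  ... | no _     | yes _    = refl
  ... | no _     | no _     = refl

  if-guard : ∀ e w → (w ≡ true → e ≡ true) → (if e then 𝟙 w else 0) ≡ 𝟙 w
  if-guard true  _     _ = refl
  if-guard false false _ = refl
  if-guard false true  h = contradiction (h refl) λ ()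

  module _ {E W : Graph n} (W⊆E : SubEdges W E) where

    inSum≡indeg : ∀ v → inSum E W v ≡ indeg W v
    inSum≡indeg v = trans (∑-allFin λ u → if E u v then Wval W u v else 0)
                          (sum-cong-≗ λ u → if-guard (E u v) (W u v) (W⊆E u v))

    outSum≡outdeg : ∀ v → outSum E W v ≡ outdeg W v
    outSum≡outdeg v = trans (∑-allFin λ w → if E v w then Wval W v w else 0)
                            (sum-cong-≗ λ w → if-guard (E v w) (W v w) (W⊆E v w))

    Condition1⇔PathBalanced : ∀ {s t} → s ≢ t → Condition1 E W s t ⇔ PathBalanced W s t
    Condition1⇔PathBalanced {s} {t} s≢t = mk⇔ (λ c1 v → to (at v) (c1 v)) (λ bal v → from (at v) (bal v))
      where
      at : ∀ v → (+ inSum E W v ℤ.- + outSum E W v ≡ demand s t v) ⇔ (indeg W v + δ v s ≡ outdeg W v + δ v t)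
      at v rewrite inSum≡indeg v | outSum≡outdeg v | demand-δ {v = v} s≢t =
        m-n≡o-p⇔m+p≡n+o (indeg W v) (outdeg W v) (δ v t) (δ v s)

lemma1 : ∀ {n : ℕ} (E W : Graph n) (s t : Fin n)
         → WeaklyConnected E → s ≢ t → IsSource E s → IsSink E t
         → SubEdges W E
         → (∃[ es ] IsWTrail W s t es) ⇔ (Condition1 E W s t × Condition2 E W t)
lemma1 E W s t _ s≢t _ t-sink W⊆E = mk⇔ necessary sufficient
  where
  W-sink : ∀ v → ¬ Adj W t v
  W-sink v h = contradiction (trans (sym (W⊆E t v h)) (t-sink v)) λ ()

  necessary : ∃[ es ] IsWTrail W s t es → Condition1 E W s t × Condition2 E W t
  necessary (es , walk , unique , enumerates) =
      from (Condition1⇔PathBalanced W⊆E s≢t) (Walk-PathBalanced w P λ _ → refl)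
    , trail⇒Condition2 W⊆E W-sink s≢t w P
    where
    w = WalkEdges⇒Walk walk
    P : Partition W es ∅
    P = record
      { unique   = unique
      ; split    = λ u v → mk⇔ (inj₁ ∘ from (enumerates (u , v))) [ to (enumerates (u , v)) , (λ ()) ]′
      ; disjoint = λ _ ()
      }

  sufficient : Condition1 E W s t × Condition2 E W t → ∃[ es ] IsWTrail W s t es
  sufficient (c1 , c2) =
    let es , w , P = eulerianTrail c2 W-sink (decompose (to (Condition1⇔PathBalanced W⊆E s≢t) c1))
    in es , Walk⇒WalkEdges s≢t w , unique P , λ _ → mk⇔ (listed⇒Adj P) (Partition-∅-listed P)
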